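{- For every integer $t \ge 0$, $f'(t;\{0,1\}) = 2^{t+1}$.
   Context: For $p,q \in X^n$, $\mathrm{dist}(p,q)$ is the Hamming distance, i.e. the number of coordinates in which $p$ and $q$ differ. For a set $X$, $f'(t;X)$ is defined as the maximum $m$ such that there exist an integer $n > t$ and $a_1,\dots,a_m,b_1,\dots,b_m \in X^n$ with $\mathrm{dist}(a_i,b_i) \ge t+1$ for all $i \in [m]$ and $\mathrm{dist}(a_i,b_j) + \mathrm{dist}(a_j,b_i) \le 2t$ for all distinct $i,j \in [m]$. -}

module Defs where

open import Data.Nat using (ℕ; zero; suc; _+_; _*_; _≤_; _<_; _^_)
open import Data.Fin using (Fin)
open import Data.Vec using (Vec; []; _∷_)
open import Data.Product using (Σ; ∃; _×_; _,_)
open import Relation.Binary.PropositionalEquality using (_≡_)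
open import Relation.Binary.Definitions using (DecidableEquality)
open import Relation.Nullary using (¬_; yes; no)

dist : {X : Set} → DecidableEquality X → {n : ℕ} → Vec X n → Vec X n → ℕ
dist _≟_ [] [] = 0
dist _≟_ (x ∷ p) (y ∷ q) with x ≟ y
... | yes _ = dist _≟_ p q
... | no  _ = suc (dist _≟_ p q)

IsConfig : {X : Set} → DecidableEquality X → (t m : ℕ) → Set
IsConfig {X} _≟_ t m =
  Σ ℕ λ n → (t < n) × Σ (Fin m → Vec X n) λ a → Σ (Fin m → Vec X n) λ b →
    ((i : Fin m) → suc t ≤ dist _≟_ (a i) (b i)) ×
    ((i j : Fin m) → ¬ (i ≡ j) →
       dist _≟_ (a i) (b j) + dist _≟_ (a j) (b i) ≤ 2 * t)

f′≡ : {X : Set} → DecidableEquality X → (t k : ℕ) → Set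
f′≡ _≟_ t k = IsConfig _≟_ t k × (∀ m → IsConfig _≟_ t m → m ≤ k)

-- For a pair (a, b) let Favours t a b be the set of words z with
-- d(z,b) − d(z,a) ≥ t, where a tie (difference exactly t) only counts if z agrees with b
-- at the first coordinate where a and b differ.  If z favours both (a, b) and (a′, b′),
-- adding d(z,b) ≤ d(z,a′) + d(a′,b) and d(z,b′) ≤ d(z,a) + d(a,b′) gives
-- d(a,b′) + d(a′,b) ≥ 2t, and the tie-break rules out equality.  So in a configuration
-- the sets Favours t aᵢ bᵢ are pairwise disjoint.  Each has at least 2ⁿ⁻ᵗ⁻¹ elements:
-- along a coordinate where a and b differ the cube splits into two halves on which the
-- threshold moves down, resp. up, by one; along other coordinates nothing changes; and at
-- threshold 0 complementation exchanges the words closer to a with those closer to b.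
-- Hence m · 2ⁿ⁻ᵗ⁻¹ ≤ 2ⁿ.
--
-- Lower bound.  All 2ᵗ⁺¹ words of length t + 1, each paired with its complement.
module Submission where

open import Defs
open import Data.Nat using (ℕ; suc; _^_)
open import Data.Bool.Properties using () renaming (_≟_ to _≟ᵇ_)
open import Data.Nat using (zero; _+_; _*_; _≤_; z≤n; s≤s; s≤s⁻¹; _≤?_)
open import Data.Nat.Properties
open import Data.Nat.Tactic.RingSolver using (solve-∀)
open import Algebra.Properties.CommutativeSemigroup +-commutativeSemigroup
  using (interchange; x∙yz≈y∙xz)
open import Data.Bool using (Bool; true; false; not; if_then_else_)
open import Data.Vec using (Vec; []; _∷_; map)
open import Data.Vec.Properties using (∷-injectiveˡ; ∷-injectiveʳ)
open import Data.Fin using (Fin; zero; suc; remQuot; combine)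
open import Data.Fin.Properties using (any?; 2↔Bool; combine-remQuot)
  renaming (suc-injective to fin-suc-injective)
open import Data.Product using (∃; _×_; _,_; proj₁; proj₂; uncurry)
open import Data.Sum using (_⊎_; inj₁; inj₂)
open import Function using (_∘_; Inverse; Injection; Injective)
open import Function.Properties.Inverse using (↔⇒↣)
open import Level using (0ℓ)
open import Relation.Binary.Definitions using (DecidableEquality)
open import Relation.Binary.PropositionalEquality
open import Relation.Nullary using (yes; no; does; contradiction)
open import Relation.Unary using (Pred; Decidable; _⊆_; _⊥_)
open import Relation.Unary.Properties using (_∪?_)

private
  suc-≤-+ : ∀ {m n s} → m ≤ n → 1 ≤ s → suc m ≤ n + s
  suc-≤-+ {m} {n} {s} m≤n 1≤s = subst (_≤ n + s) (+-comm m 1) (+-mono-≤ m≤n 1≤s)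

  glue : ∀ u v r s {p q} → p ≤ u + r → q ≤ v + s → p + q ≤ (u + v) + (r + s)
  glue u v r s p≤ q≤ = ≤-trans (+-mono-≤ p≤ q≤) (≤-reflexive (interchange u r v s))

  2^suc : ∀ n → 2 ^ suc n ≡ 2 ^ n + 2 ^ n
  2^suc n = cong (2 ^ n +_) (+-identityʳ (2 ^ n))

  double-bound : ∀ {n k c c′} → 2 ^ n ≤ k * c → c + c ≤ c′ → 2 ^ suc n ≤ k * c′
  double-bound {n} {k} {c} {c′} h c+c≤c′ = begin
    2 ^ suc n        ≡⟨ 2^suc n ⟩
    2 ^ n + 2 ^ n    ≤⟨ +-mono-≤ h h ⟩
    k * c + k * c    ≡⟨ *-distribˡ-+ k c c ⟨
    k * (c + c)      ≤⟨ *-monoʳ-≤ k c+c≤c′ ⟩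
    k * c′           ∎
    where open ≤-Reasoning

  shift-bound : ∀ {n τ c c′} → 2 ^ n ≤ 2 ^ τ * c → c ≤ c′ → 2 ^ suc n ≤ 2 ^ suc τ * c′
  shift-bound {n} {τ} {c} {c′} h c≤c′ = begin
    2 * 2 ^ n        ≤⟨ *-monoʳ-≤ 2 h ⟩
    2 * (2 ^ τ * c)  ≡⟨ *-assoc 2 (2 ^ τ) c ⟨
    2 ^ suc τ * c    ≤⟨ *-monoʳ-≤ (2 ^ suc τ) c≤c′ ⟩
    2 ^ suc τ * c′   ∎
    where open ≤-Reasoning

module Crossing {A : Set} (ρ : A → A → ℕ) where

  direct : A → A → A → ℕ
  direct z b b′ = ρ z b + ρ z b′

  detour : A → A → A → A → A → ℕ
  detour z a b a′ b′ = (ρ z a + ρ z a′) + (ρ a b′ + ρ a′ b)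

  direct≤detour : (∀ x y z → ρ x z ≤ ρ x y + ρ y z) →
                  ∀ z a b a′ b′ → direct z b b′ ≤ detour z a b a′ b′
  direct≤detour triangle z a b a′ b′ = begin
    ρ z b + ρ z b′                          ≤⟨ +-mono-≤ (triangle z a′ b) (triangle z a b′) ⟩
    (ρ z a′ + ρ a′ b) + (ρ z a + ρ a b′)    ≡⟨ +-comm (ρ z a′ + ρ a′ b) _ ⟩
    (ρ z a + ρ a b′) + (ρ z a′ + ρ a′ b)    ≡⟨ interchange (ρ z a) (ρ a b′) (ρ z a′) (ρ a′ b) ⟩
    (ρ z a + ρ z a′) + (ρ a b′ + ρ a′ b)    ∎
    where open ≤-Reasoning

module Hamming {X : Set} (_≟_ : DecidableEquality X) where

  open Crossing

  d : ∀ {n} → Vec X n → Vec X n → ℕ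
  d = dist _≟_

  δ : X → X → ℕ
  δ x y = if does (x ≟ y) then 0 else 1

  private variable
    n : ℕ
    x y : X

  dist-∷ : ∀ x y (a b : Vec X n) → d (x ∷ a) (y ∷ b) ≡ δ x y + d a b
  dist-∷ x y a b with x ≟ y
  ... | yes _ = refl
  ... | no  _ = refl

  δ-refl : ∀ x → δ x x ≡ 0
  δ-refl x with x ≟ x
  ... | yes _   = refl
  ... | no  x≢x = contradiction refl x≢x

  δ-≢ : x ≢ y → δ x y ≡ 1
  δ-≢ {x} {y} x≢y with x ≟ y
  ... | yes x≡y = contradiction x≡y x≢y
  ... | no  _   = refl

  δ-sym : ∀ x y → δ x y ≡ δ y x
  δ-sym x y with x ≟ y | y ≟ x
  ... | yes _   | yes _   = refl
  ... | no  _   | no  _   = refl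
  ... | yes x≡y | no  y≢x = contradiction (sym x≡y) y≢x
  ... | no  x≢y | yes y≡x = contradiction (sym y≡x) x≢y

  δ≤1 : ∀ x y → δ x y ≤ 1
  δ≤1 x y with x ≟ y
  ... | yes _ = z≤n
  ... | no  _ = ≤-refl

  δ-triangle : ∀ x y z → δ x z ≤ δ x y + δ y z
  δ-triangle x y z with x ≟ y
  ... | no  _    = ≤-trans (δ≤1 x z) (m≤m+n 1 (δ y z))
  ... | yes refl = ≤-refl

  dist-refl : ∀ (a : Vec X n) → d a a ≡ 0
  dist-refl []      = refl
  dist-refl (x ∷ a) = trans (dist-∷ x x a a) (cong₂ _+_ (δ-refl x) (dist-refl a))

  dist≡0⇒≡ : ∀ (a b : Vec X n) → d a b ≡ 0 → a ≡ b
  dist≡0⇒≡ []      []      _  = refl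
  dist≡0⇒≡ (x ∷ a) (y ∷ b) eq with x ≟ y
  ... | yes refl = cong (x ∷_) (dist≡0⇒≡ a b eq)
  ... | no  _    = contradiction (sym eq) 0≢1+n

  dist-triangle : ∀ (a b c : Vec X n) → d a c ≤ d a b + d b c
  dist-triangle []      []      []      = z≤n
  dist-triangle (x ∷ a) (y ∷ b) (w ∷ c) = begin
    d (x ∷ a) (w ∷ c)                      ≡⟨ dist-∷ x w a c ⟩
    δ x w + d a c                          ≤⟨ +-mono-≤ (δ-triangle x y w) (dist-triangle a b c) ⟩
    (δ x y + δ y w) + (d a b + d b c)      ≡⟨ interchange (δ x y) (δ y w) (d a b) (d b c) ⟩
    (δ x y + d a b) + (δ y w + d b c)      ≡⟨ cong₂ _+_ (dist-∷ x y a b) (dist-∷ y w b c) ⟨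
    d (x ∷ a) (y ∷ b) + d (y ∷ b) (w ∷ c)  ∎
    where open ≤-Reasoning

  tieBreak : Vec X n → Vec X n → Vec X n → ℕ
  tieBreak []      []      []      = 0
  tieBreak (x ∷ a) (y ∷ b) (w ∷ z) with x ≟ y
  ... | yes _ = tieBreak a b z
  ... | no  _ = δ w y

  tieBreak-∷-same : ∀ x w (a b z : Vec X n) → tieBreak (x ∷ a) (x ∷ b) (w ∷ z) ≡ tieBreak a b z
  tieBreak-∷-same x w a b z with x ≟ x
  ... | yes _   = refl
  ... | no  x≢x = contradiction refl x≢x

  tieBreak-∷-≢ : ∀ w (a b z : Vec X n) → x ≢ y → tieBreak (x ∷ a) (y ∷ b) (w ∷ z) ≡ δ w y
  tieBreak-∷-≢ {x = x} {y} w a b z x≢y with x ≟ y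
  ... | yes x≡y = contradiction x≡y x≢y
  ... | no  _   = refl

  Closer : ℕ → Vec X n → Vec X n → Pred (Vec X n) 0ℓ
  Closer τ a b z = τ + d z a ≤ d z b

  closer? : ∀ τ (a b : Vec X n) → Decidable (Closer τ a b)
  closer? τ a b z = τ + d z a ≤? d z b

  Favours : ℕ → Vec X n → Vec X n → Pred (Vec X n) 0ℓ
  Favours t a b z = Closer (tieBreak a b z + t) a b z

  favours? : ∀ t (a b : Vec X n) → Decidable (Favours t a b)
  favours? t a b z = closer? (tieBreak a b z + t) a b z

  direct-∷ : ∀ w y y′ (z b b′ : Vec X n) →
             direct d (w ∷ z) (y ∷ b) (y′ ∷ b′) ≡ direct δ w y y′ + direct d z b b′
  direct-∷ w y y′ z b b′ =
    trans (cong₂ _+_ (dist-∷ w y z b) (dist-∷ w y′ z b′)) (interchange (δ w y) _ (δ w y′) _)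

  detour-∷ : ∀ w x y x′ y′ (z a b a′ b′ : Vec X n) →
             detour d (w ∷ z) (x ∷ a) (y ∷ b) (x′ ∷ a′) (y′ ∷ b′) ≡
             detour δ w x y x′ y′ + detour d z a b a′ b′
  detour-∷ w x y x′ y′ z a b a′ b′ = begin
    (d (w ∷ z) (x ∷ a) + d (w ∷ z) (x′ ∷ a′)) + (d (x ∷ a) (y′ ∷ b′) + d (x′ ∷ a′) (y ∷ b))
      ≡⟨ cong₂ _+_ (direct-∷ w x x′ z a a′) (cong₂ _+_ (dist-∷ x y′ a b′) (dist-∷ x′ y a′ b)) ⟩
    (direct δ w x x′ + direct d z a a′) + ((δ x y′ + d a b′) + (δ x′ y + d a′ b))
      ≡⟨ cong (direct δ w x x′ + direct d z a a′ +_) (interchange (δ x y′) _ (δ x′ y) _) ⟩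
    (direct δ w x x′ + direct d z a a′) + ((δ x y′ + δ x′ y) + (d a b′ + d a′ b))
      ≡⟨ interchange (direct δ w x x′) _ (δ x y′ + δ x′ y) _ ⟩
    detour δ w x y x′ y′ + detour d z a b a′ b′
      ∎
    where open ≡-Reasoning

  -- The first-letter cases of crossed-triangles in which a pair of letters differs;
  -- x ≢ y or x′ ≢ y′ supplies the one unit of slack through the letter triangle inequality.
  δ-crossed₁ : ∀ w x y x′ → x ≢ y → suc (direct δ w y x′) ≤ δ w y + detour δ w x y x′ x′
  δ-crossed₁ w x y x′ x≢y = begin
    suc (δ w y + δ w x′)          ≡⟨ +-suc (δ w y) (δ w x′) ⟨
    δ w y + suc (δ w x′)          ≤⟨ +-monoʳ-≤ (δ w y) (suc-≤-+ (m≤n+m (δ w x′) (δ w x)) slack) ⟩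
    δ w y + detour δ w x y x′ x′  ∎
    where
    open ≤-Reasoning
    slack : 1 ≤ δ x x′ + δ x′ y
    slack = subst (_≤ δ x x′ + δ x′ y) (δ-≢ x≢y) (δ-triangle x x′ y)

  δ-crossed₂ : ∀ w x x′ y′ → x′ ≢ y′ → suc (direct δ w x y′) ≤ δ w y′ + detour δ w x x x′ y′
  δ-crossed₂ w x x′ y′ x′≢y′ = begin
    suc (δ w x + δ w y′)          ≡⟨ cong suc (+-comm (δ w x) (δ w y′)) ⟩
    suc (δ w y′ + δ w x)          ≡⟨ +-suc (δ w y′) (δ w x) ⟨
    δ w y′ + suc (δ w x)          ≤⟨ +-monoʳ-≤ (δ w y′) (suc-≤-+ (m≤m+n (δ w x) (δ w x′)) slack) ⟩
    δ w y′ + detour δ w x x x′ y′ ∎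
    where
    open ≤-Reasoning
    slack : 1 ≤ δ x y′ + δ x′ x
    slack = subst₂ _≤_ (δ-≢ x′≢y′) (+-comm (δ x′ x) (δ x y′)) (δ-triangle x′ x y′)

  δ-crossed₃ : ∀ w x y x′ y′ → x′ ≢ y′ →
               suc (direct δ w y y′) ≤ (δ w y + δ w y′) + detour δ w x y x′ y′
  δ-crossed₃ w x y x′ y′ x′≢y′ = suc-≤-+ ≤-refl (begin
    1                             ≡⟨ δ-≢ x′≢y′ ⟨
    δ x′ y′                       ≤⟨ δ-triangle x′ w y′ ⟩
    δ x′ w + δ w y′               ≤⟨ +-monoʳ-≤ (δ x′ w) (δ-triangle w x y′) ⟩
    δ x′ w + (δ w x + δ x y′)     ≡⟨ cong (_+ (δ w x + δ x y′)) (δ-sym x′ w) ⟩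
    δ w x′ + (δ w x + δ x y′)     ≡⟨ x∙yz≈y∙xz (δ w x′) (δ w x) (δ x y′) ⟩
    δ w x + (δ w x′ + δ x y′)     ≡⟨ +-assoc (δ w x) (δ w x′) (δ x y′) ⟨
    (δ w x + δ w x′) + δ x y′     ≤⟨ +-monoʳ-≤ (δ w x + δ w x′) (m≤m+n (δ x y′) (δ x′ y)) ⟩
    detour δ w x y x′ y′          ∎)
    where open ≤-Reasoning

  -- While both pairs agree in their first letter the claim passes to the tails; at the first
  -- letter where a pair differs, its tie-break term pays for the strict inequality.
  crossed-triangles : ∀ {z a b a′ b′ : Vec X n} → a ≢ b → a′ ≢ b′ →
    suc (direct d z b b′) ≤ (tieBreak a b z + tieBreak a′ b′ z) + detour d z a b a′ b′
  crossed-triangles {z = []} {[]} {[]} a≢b _ = contradiction refl a≢b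
  crossed-triangles {z = w ∷ z} {x ∷ a} {y ∷ b} {x′ ∷ a′} {y′ ∷ b′} xa≢yb xa′≢yb′
    rewrite direct-∷ w y y′ z b b′ | detour-∷ w x y x′ y′ z a b a′ b′
    with x ≟ y | x′ ≟ y′
  ... | yes refl | yes refl = begin
    suc (direct δ w y y′ + direct d z b b′)  ≡⟨ +-suc (direct δ w y y′) (direct d z b b′) ⟨
    direct δ w y y′ + suc (direct d z b b′)
      ≤⟨ glue 0 (tieBreak a b z + tieBreak a′ b′ z) (detour δ w y y y′ y′) (detour d z a b a′ b′)
              (direct≤detour δ δ-triangle w y y y′ y′)
              (crossed-triangles {z = z} (xa≢yb ∘ cong (y ∷_)) (xa′≢yb′ ∘ cong (y′ ∷_))) ⟩
    (tieBreak a b z + tieBreak a′ b′ z) + (detour δ w y y y′ y′ + detour d z a b a′ b′)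
      ∎
    where open ≤-Reasoning
  ... | no x≢y   | yes refl =
    glue (δ w y) (tieBreak a′ b′ z) (detour δ w x y y′ y′) (detour d z a b a′ b′)
      (δ-crossed₁ w x y y′ x≢y)
      (m≤n⇒m≤o+n (tieBreak a′ b′ z) (direct≤detour d dist-triangle z a b a′ b′))
  ... | yes refl | no x′≢y′ = begin
    suc (direct δ w y y′ + direct d z b b′)
      ≤⟨ glue (δ w y′) (tieBreak a b z) (detour δ w y y x′ y′) (detour d z a b a′ b′)
              (δ-crossed₂ w y x′ y′ x′≢y′)
              (m≤n⇒m≤o+n (tieBreak a b z) (direct≤detour d dist-triangle z a b a′ b′)) ⟩
    (δ w y′ + tieBreak a b z) + (detour δ w y y x′ y′ + detour d z a b a′ b′)
      ≡⟨ cong (_+ (detour δ w y y x′ y′ + detour d z a b a′ b′)) (+-comm (δ w y′) (tieBreak a b z)) ⟩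
    (tieBreak a b z + δ w y′) + (detour δ w y y x′ y′ + detour d z a b a′ b′)
      ∎
    where open ≤-Reasoning
  ... | no _     | no x′≢y′ = begin
    suc (direct δ w y y′ + direct d z b b′)
      ≤⟨ +-mono-≤ (δ-crossed₃ w x y x′ y′ x′≢y′) (direct≤detour d dist-triangle z a b a′ b′) ⟩
    ((δ w y + δ w y′) + detour δ w x y x′ y′) + detour d z a b a′ b′
      ≡⟨ +-assoc (δ w y + δ w y′) (detour δ w x y x′ y′) (detour d z a b a′ b′) ⟩
    (δ w y + δ w y′) + (detour δ w x y x′ y′ + detour d z a b a′ b′)
      ∎
    where open ≤-Reasoning

  favours-separated : ∀ {t} {z a b a′ b′ : Vec X n} → a ≢ b → a′ ≢ b′ →
                      Favours t a b z → Favours t a′ b′ z → suc (2 * t) ≤ d a b′ + d a′ b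
  favours-separated {t = t} {z} {a} {b} {a′} {b′} a≢b a′≢b′ fav fav′ =
    +-cancelˡ-≤ (T + A) (suc (2 * t)) (d a b′ + d a′ b) (begin
      (T + A) + suc (2 * t)
        ≡⟨ rearrange (tieBreak a b z) (tieBreak a′ b′ z) t (d z a) (d z a′) ⟩
      suc (((tieBreak a b z + t) + d z a) + ((tieBreak a′ b′ z + t) + d z a′))
        ≤⟨ s≤s (+-mono-≤ fav fav′) ⟩
      suc (direct d z b b′)
        ≤⟨ crossed-triangles a≢b a′≢b′ ⟩
      T + (A + (d a b′ + d a′ b))
        ≡⟨ +-assoc T A (d a b′ + d a′ b) ⟨
      (T + A) + (d a b′ + d a′ b)
        ∎)
    where
    open ≤-Reasoning
    T A : ℕ
    T = tieBreak a b z + tieBreak a′ b′ z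
    A = d z a + d z a′
    rearrange : ∀ r r′ t p p′ →
                (r + r′) + (p + p′) + suc (2 * t) ≡ suc (((r + t) + p) + ((r′ + t) + p′))
    rearrange = solve-∀

  closer-∷-same : ∀ τ (a b : Vec X n) x w → Closer τ a b ⊆ Closer τ (x ∷ a) (x ∷ b) ∘ (w ∷_)
  closer-∷-same τ a b x w {z} closer = begin
    τ + d (w ∷ z) (x ∷ a)   ≡⟨ cong (τ +_) (dist-∷ w x z a) ⟩
    τ + (δ w x + d z a)     ≡⟨ x∙yz≈y∙xz τ (δ w x) (d z a) ⟩
    δ w x + (τ + d z a)     ≤⟨ +-monoʳ-≤ (δ w x) closer ⟩
    δ w x + d z b           ≡⟨ dist-∷ w x z b ⟨
    d (w ∷ z) (x ∷ b)       ∎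
    where open ≤-Reasoning

  closer-∷-agree : ∀ τ (a b : Vec X n) → x ≢ y → Closer τ a b ⊆ Closer (suc τ) (x ∷ a) (y ∷ b) ∘ (x ∷_)
  closer-∷-agree {x = x} {y} τ a b x≢y {z} closer = begin
    suc τ + d (x ∷ z) (x ∷ a)   ≡⟨ cong (suc τ +_) (trans (dist-∷ x x z a) (cong (_+ d z a) (δ-refl x))) ⟩
    suc (τ + d z a)             ≤⟨ s≤s closer ⟩
    suc (d z b)                 ≡⟨ trans (dist-∷ x y z b) (cong (_+ d z b) (δ-≢ x≢y)) ⟨
    d (x ∷ z) (y ∷ b)           ∎
    where open ≤-Reasoning

  favours-∷-same : ∀ t (a b : Vec X n) x w → Favours t a b ⊆ Favours t (x ∷ a) (x ∷ b) ∘ (w ∷_)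
  favours-∷-same t a b x w {z} fav =
    subst (λ r → Closer (r + t) (x ∷ a) (x ∷ b) (w ∷ z)) (sym (tieBreak-∷-same x w a b z))
      (closer-∷-same _ a b x w fav)

  favours-∷-agree : ∀ t (a b : Vec X n) → x ≢ y → Closer t a b ⊆ Favours t (x ∷ a) (y ∷ b) ∘ (x ∷_)
  favours-∷-agree {x = x} {y} t a b x≢y {z} closer =
    subst (λ r → Closer (r + t) (x ∷ a) (y ∷ b) (x ∷ z))
      (sym (trans (tieBreak-∷-≢ x a b z x≢y) (δ-≢ x≢y)))
      (closer-∷-agree t a b x≢y closer)

  favours-∷-disagree : ∀ t (a b : Vec X n) → x ≢ y →
                       Closer (suc t) a b ⊆ Favours t (x ∷ a) (y ∷ b) ∘ (y ∷_)
  favours-∷-disagree {x = x} {y} t a b x≢y {z} closer = begin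
    tieBreak (x ∷ a) (y ∷ b) (y ∷ z) + t + d (y ∷ z) (x ∷ a)
      ≡⟨ cong₂ (λ r s → r + t + s) (trans (tieBreak-∷-≢ y a b z x≢y) (δ-refl y)) (dist-∷ y x z a) ⟩
    t + (δ y x + d z a)      ≡⟨ cong (λ r → t + (r + d z a)) (δ-≢ (x≢y ∘ sym)) ⟩
    t + suc (d z a)          ≡⟨ +-suc t (d z a) ⟩
    suc t + d z a            ≤⟨ closer ⟩
    d z b                    ≡⟨ cong (_+ d z b) (δ-refl y) ⟨
    δ y y + d z b            ≡⟨ dist-∷ y y z b ⟨
    d (y ∷ z) (y ∷ b)        ∎
    where open ≤-Reasoning

private variable
  n : ℕ

count : ∀ {n p} {P : Pred (Vec Bool n) p} → Decidable P → ℕ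
count {zero}  P? = if does (P? []) then 1 else 0
count {suc n} P? = count (P? ∘ (true ∷_)) + count (P? ∘ (false ∷_))

count-mono : ∀ {p q} {P : Pred (Vec Bool n) p} {Q : Pred (Vec Bool n) q}
             (P? : Decidable P) (Q? : Decidable Q) → P ⊆ Q → count P? ≤ count Q?
count-mono {zero} P? Q? P⊆Q with P? [] | Q? []
... | yes _ | yes _ = ≤-refl
... | yes p | no ¬q = contradiction (P⊆Q p) ¬q
... | no _  | _     = z≤n
count-mono {suc n} P? Q? P⊆Q =
  +-mono-≤ (count-mono (P? ∘ (true ∷_)) (Q? ∘ (true ∷_)) P⊆Q)
           (count-mono (P? ∘ (false ∷_)) (Q? ∘ (false ∷_)) P⊆Q)

count≤2^n : ∀ {p} {P : Pred (Vec Bool n) p} (P? : Decidable P) → count P? ≤ 2 ^ n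
count≤2^n {zero} P? with P? []
... | yes _ = ≤-refl
... | no  _ = z≤n
count≤2^n {suc n} P? = subst (count P? ≤_) (sym (2^suc n))
  (+-mono-≤ (count≤2^n (P? ∘ (true ∷_))) (count≤2^n (P? ∘ (false ∷_))))

count-cover : ∀ {p q} {P : Pred (Vec Bool n) p} {Q : Pred (Vec Bool n) q}
              (P? : Decidable P) (Q? : Decidable Q) → (∀ z → P z ⊎ Q z) →
              2 ^ n ≤ count P? + count Q?
count-cover {zero} P? Q? cover with P? [] | Q? [] | cover []
... | yes _ | _     | _      = s≤s z≤n
... | no _  | yes _ | _      = ≤-refl
... | no ¬p | no _  | inj₁ p = contradiction p ¬p
... | no _  | no ¬q | inj₂ q = contradiction q ¬q
count-cover {suc n} P? Q? cover = begin
  2 ^ suc n                ≡⟨ 2^suc n ⟩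
  2 ^ n + 2 ^ n            ≤⟨ +-mono-≤ (count-cover (P? ∘ (true ∷_)) (Q? ∘ (true ∷_)) (cover ∘ (true ∷_)))
                                       (count-cover (P? ∘ (false ∷_)) (Q? ∘ (false ∷_)) (cover ∘ (false ∷_))) ⟩
  (P₁ + Q₁) + (P₀ + Q₀)    ≡⟨ interchange P₁ Q₁ P₀ Q₀ ⟩
  (P₁ + P₀) + (Q₁ + Q₀)    ∎
  where
  open ≤-Reasoning
  P₁ P₀ Q₁ Q₀ : ℕ
  P₁ = count (P? ∘ (true ∷_))
  P₀ = count (P? ∘ (false ∷_))
  Q₁ = count (Q? ∘ (true ∷_))
  Q₀ = count (Q? ∘ (false ∷_))

count-disjoint : ∀ {p q} {P : Pred (Vec Bool n) p} {Q : Pred (Vec Bool n) q}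
                 (P? : Decidable P) (Q? : Decidable Q) → P ⊥ Q →
                 count P? + count Q? ≤ count (P? ∪? Q?)
count-disjoint {zero} P? Q? P⊥Q with P? [] | Q? []
... | yes p | yes q = contradiction (p , q) P⊥Q
... | yes _ | no _  = ≤-refl
... | no _  | yes _ = ≤-refl
... | no _  | no _  = z≤n
count-disjoint {suc n} P? Q? P⊥Q = begin
  (P₁ + P₀) + (Q₁ + Q₀)    ≡⟨ interchange P₁ P₀ Q₁ Q₀ ⟩
  (P₁ + Q₁) + (P₀ + Q₀)    ≤⟨ +-mono-≤ (count-disjoint (P? ∘ (true ∷_)) (Q? ∘ (true ∷_)) P⊥Q)
                                       (count-disjoint (P? ∘ (false ∷_)) (Q? ∘ (false ∷_)) P⊥Q) ⟩
  count (P? ∪? Q?)         ∎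
  where
  open ≤-Reasoning
  P₁ P₀ Q₁ Q₀ : ℕ
  P₁ = count (P? ∘ (true ∷_))
  P₀ = count (P? ∘ (false ∷_))
  Q₁ = count (Q? ∘ (true ∷_))
  Q₀ = count (Q? ∘ (false ∷_))

count-not : ∀ {p} {P : Pred (Vec Bool n) p} (P? : Decidable P) → count (P? ∘ map not) ≡ count P?
count-not {zero}  P? = refl
count-not {suc n} P? =
  trans (cong₂ _+_ (count-not (P? ∘ (false ∷_))) (count-not (P? ∘ (true ∷_))))
        (+-comm (count (P? ∘ (false ∷_))) (count (P? ∘ (true ∷_))))

module _ {p} {P : Pred (Vec Bool (suc n)) p} (P? : Decidable P) where

  count-∷ : ∀ x → count (P? ∘ (x ∷_)) ≤ count P?
  count-∷ true  = m≤m+n _ _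
  count-∷ false = m≤n+m _ _

  count-split : ∀ {x y} → x ≢ y → count (P? ∘ (x ∷_)) + count (P? ∘ (y ∷_)) ≡ count P?
  count-split {true}  {false} _   = refl
  count-split {false} {true}  _   = +-comm (count (P? ∘ (false ∷_))) (count (P? ∘ (true ∷_)))
  count-split {true}  {true}  x≢y = contradiction refl x≢y
  count-split {false} {false} x≢y = contradiction refl x≢y

  count-double : ∀ {q} {Q : Pred (Vec Bool n) q} (Q? : Decidable Q) →
                 (∀ w → Q ⊆ P ∘ (w ∷_)) → count Q? + count Q? ≤ count P?
  count-double Q? Q⊆P = +-mono-≤ (count-mono Q? (P? ∘ (true ∷_)) (Q⊆P true))
                                 (count-mono Q? (P? ∘ (false ∷_)) (Q⊆P false))

count-⋃ : ∀ {ℓ m K C} {P : Fin m → Pred (Vec Bool n) ℓ} (P? : ∀ i → Decidable (P i)) →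
          (∀ i j → i ≢ j → P i ⊥ P j) → (∀ i → K ≤ C * count (P? i)) →
          m * K ≤ C * count (λ z → any? λ i → P? i z)
count-⋃ {m = zero}  P? disjoint large = z≤n
count-⋃ {m = suc m} {K} {C} {P} P? disjoint large = begin
  K + m * K                           ≤⟨ +-mono-≤ (large zero) (count-⋃ {C = C} (P? ∘ suc) disjoint-suc (large ∘ suc)) ⟩
  C * count (P? zero) + C * count R?  ≡⟨ *-distribˡ-+ C (count (P? zero)) (count R?) ⟨
  C * (count (P? zero) + count R?)    ≤⟨ *-monoʳ-≤ C (count-disjoint (P? zero) R? head-disjoint) ⟩
  C * count (P? zero ∪? R?)           ≤⟨ *-monoʳ-≤ C (count-mono (P? zero ∪? R?) ⋃P? widen) ⟩
  C * count ⋃P?                       ∎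
  where
  open ≤-Reasoning
  ⋃P? : Decidable (λ z → ∃ λ i → P i z)
  ⋃P? z = any? λ i → P? i z
  R? : Decidable (λ z → ∃ λ i → P (suc i) z)
  R? z = any? λ i → P? (suc i) z
  disjoint-suc : ∀ i j → i ≢ j → P (suc i) ⊥ P (suc j)
  disjoint-suc i j i≢j = disjoint (suc i) (suc j) (i≢j ∘ fin-suc-injective)
  head-disjoint : P zero ⊥ (λ z → ∃ λ i → P (suc i) z)
  head-disjoint (p , i , q) = disjoint zero (suc i) (λ ()) (p , q)
  widen : ∀ {z} → P zero z ⊎ (∃ λ i → P (suc i) z) → ∃ λ i → P i z
  widen (inj₁ p)       = zero , p
  widen (inj₂ (i , p)) = suc i , p

open Hamming _≟ᵇ_

dist-not : ∀ (z a : Vec Bool n) → d (map not z) a + d z a ≡ n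
dist-not []          []          = refl
dist-not (true  ∷ z) (true  ∷ a) = cong suc (dist-not z a)
dist-not (false ∷ z) (false ∷ a) = cong suc (dist-not z a)
dist-not (true  ∷ z) (false ∷ a) = trans (+-suc _ _) (cong suc (dist-not z a))
dist-not (false ∷ z) (true  ∷ a) = trans (+-suc _ _) (cong suc (dist-not z a))

closer-flip : ∀ τ (a b : Vec Bool n) → Closer τ b a ⊆ Closer τ a b ∘ map not
closer-flip {n} τ a b {z} closer = +-cancelʳ-≤ (d z b) (τ + d z̄ a) (d z̄ b) (begin
  (τ + d z̄ a) + d z b   ≡⟨ +-assoc τ (d z̄ a) (d z b) ⟩
  τ + (d z̄ a + d z b)   ≡⟨ x∙yz≈y∙xz τ (d z̄ a) (d z b) ⟩
  d z̄ a + (τ + d z b)   ≤⟨ +-monoʳ-≤ (d z̄ a) closer ⟩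
  d z̄ a + d z a         ≡⟨ dist-not z a ⟩
  n                     ≡⟨ dist-not z b ⟨
  d z̄ b + d z b         ∎)
  where
  open ≤-Reasoning
  z̄ : Vec Bool n
  z̄ = map not z

closers-count-0 : ∀ (a b : Vec Bool n) → 2 ^ n ≤ count (closer? 0 a b) + count (closer? 1 a b)
closers-count-0 {n} a b = begin
  2 ^ n                                          ≤⟨ count-cover _ _ closer-or-closer ⟩
  count (closer? 0 a b) + count (closer? 1 b a)  ≤⟨ +-monoʳ-≤ (count (closer? 0 a b)) flipped ⟩
  count (closer? 0 a b) + count (closer? 1 a b)  ∎
  where
  open ≤-Reasoning
  closer-or-closer : ∀ z → Closer 0 a b z ⊎ Closer 1 b a z
  closer-or-closer z with d z a ≤? d z b
  ... | yes za≤zb = inj₁ za≤zb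
  ... | no  za≰zb = inj₂ (≰⇒> za≰zb)
  flipped : count (closer? 1 b a) ≤ count (closer? 1 a b)
  flipped = ≤-trans (count-mono (closer? 1 b a) (closer? 1 a b ∘ map not) (λ {z} → closer-flip 1 a b {z}))
                    (≤-reflexive (count-not (closer? 1 a b)))

Closers : ℕ → Vec Bool n → Vec Bool n → ℕ
Closers τ a b = count (closer? τ a b) + count (closer? (suc τ) a b)

closers-count-∷-same : ∀ τ x (a b : Vec Bool n) →
                       2 ^ n ≤ 2 ^ τ * Closers τ a b → 2 ^ suc n ≤ 2 ^ τ * Closers τ (x ∷ a) (x ∷ b)
closers-count-∷-same {n} τ x a b h = double-bound {n} {2 ^ τ} h (begin
  (C₀ + C₁) + (C₀ + C₁)   ≡⟨ interchange C₀ C₁ C₀ C₁ ⟩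
  (C₀ + C₀) + (C₁ + C₁)   ≤⟨ +-mono-≤ (count-double (closer? τ (x ∷ a) (x ∷ b)) (closer? τ a b)
                                         (closer-∷-same τ a b x))
                                       (count-double (closer? (suc τ) (x ∷ a) (x ∷ b)) (closer? (suc τ) a b)
                                         (closer-∷-same (suc τ) a b x)) ⟩
  Closers τ (x ∷ a) (x ∷ b) ∎)
  where
  open ≤-Reasoning
  C₀ C₁ : ℕ
  C₀ = count (closer? τ a b)
  C₁ = count (closer? (suc τ) a b)

closers-count-∷-≢ : ∀ τ x y (a b : Vec Bool n) → x ≢ y →
                    2 ^ n ≤ 2 ^ τ * Closers τ a b →
                    2 ^ suc n ≤ 2 ^ suc τ * Closers (suc τ) (x ∷ a) (y ∷ b)
closers-count-∷-≢ {n} τ x y a b x≢y h = shift-bound {n} {τ} h (+-mono-≤ (step τ) (step (suc τ)))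
  where
  step : ∀ σ → count (closer? σ a b) ≤ count (closer? (suc σ) (x ∷ a) (y ∷ b))
  step σ = ≤-trans (count-mono (closer? σ a b) (closer? (suc σ) (x ∷ a) (y ∷ b) ∘ (x ∷_))
                                (closer-∷-agree σ a b x≢y))
                   (count-∷ (closer? (suc σ) (x ∷ a) (y ∷ b)) x)

closers-count : ∀ τ (a b : Vec Bool n) → τ ≤ d a b → 2 ^ n ≤ 2 ^ τ * Closers τ a b
closers-count {n} zero a b _ = subst (2 ^ n ≤_) (sym (*-identityˡ (Closers 0 a b))) (closers-count-0 a b)
closers-count (suc τ) [] [] ()
closers-count (suc τ) (true  ∷ a) (true  ∷ b) h =
  closers-count-∷-same (suc τ) true a b (closers-count (suc τ) a b h)
closers-count (suc τ) (false ∷ a) (false ∷ b) h =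
  closers-count-∷-same (suc τ) false a b (closers-count (suc τ) a b h)
closers-count (suc τ) (true  ∷ a) (false ∷ b) h =
  closers-count-∷-≢ τ true false a b (λ ()) (closers-count τ a b (s≤s⁻¹ h))
closers-count (suc τ) (false ∷ a) (true  ∷ b) h =
  closers-count-∷-≢ τ false true a b (λ ()) (closers-count τ a b (s≤s⁻¹ h))

favours-count-∷-same : ∀ t x (a b : Vec Bool n) →
                       2 ^ n ≤ 2 ^ suc t * count (favours? t a b) →
                       2 ^ suc n ≤ 2 ^ suc t * count (favours? t (x ∷ a) (x ∷ b))
favours-count-∷-same {n} t x a b h = double-bound {n} {2 ^ suc t} h
  (count-double (favours? t (x ∷ a) (x ∷ b)) (favours? t a b) (favours-∷-same t a b x))

favours-count-∷-≢ : ∀ t x y (a b : Vec Bool n) → x ≢ y →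
                    2 ^ n ≤ 2 ^ t * Closers t a b →
                    2 ^ suc n ≤ 2 ^ suc t * count (favours? t (x ∷ a) (y ∷ b))
favours-count-∷-≢ {n} t x y a b x≢y h = shift-bound {n} {t} h (begin
  count (closer? t a b) + count (closer? (suc t) a b)
    ≤⟨ +-mono-≤ (count-mono (closer? t a b) (F? ∘ (x ∷_)) (favours-∷-agree t a b x≢y))
                (count-mono (closer? (suc t) a b) (F? ∘ (y ∷_)) (favours-∷-disagree t a b x≢y)) ⟩
  count (F? ∘ (x ∷_)) + count (F? ∘ (y ∷_))
    ≡⟨ count-split F? x≢y ⟩
  count F?
    ∎)
  where
  open ≤-Reasoning
  F? : Decidable (Favours t (x ∷ a) (y ∷ b))
  F? = favours? t (x ∷ a) (y ∷ b)

favours-count : ∀ t (a b : Vec Bool n) → suc t ≤ d a b → 2 ^ n ≤ 2 ^ suc t * count (favours? t a b)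
favours-count t [] [] ()
favours-count t (true  ∷ a) (true  ∷ b) h = favours-count-∷-same t true a b (favours-count t a b h)
favours-count t (false ∷ a) (false ∷ b) h = favours-count-∷-same t false a b (favours-count t a b h)
favours-count t (true  ∷ a) (false ∷ b) h =
  favours-count-∷-≢ t true false a b (λ ()) (closers-count t a b (s≤s⁻¹ h))
favours-count t (false ∷ a) (true  ∷ b) h =
  favours-count-∷-≢ t false true a b (λ ()) (closers-count t a b (s≤s⁻¹ h))

config-upper : ∀ t m → IsConfig _≟ᵇ_ t m → m ≤ 2 ^ suc t
config-upper t m (n , _ , a , b , far , near) = *-cancelʳ-≤ m (2 ^ suc t) (2 ^ n) {{m^n≢0 2 n}} (begin
  m * 2 ^ n                 ≤⟨ count-⋃ {C = 2 ^ suc t} F? disjoint large ⟩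
  2 ^ suc t * count ⋃F?     ≤⟨ *-monoʳ-≤ (2 ^ suc t) (count≤2^n ⋃F?) ⟩
  2 ^ suc t * 2 ^ n         ∎)
  where
  open ≤-Reasoning
  F? : ∀ i → Decidable (Favours t (a i) (b i))
  F? i = favours? t (a i) (b i)
  large : ∀ i → 2 ^ n ≤ 2 ^ suc t * count (F? i)
  large i = favours-count t (a i) (b i) (far i)
  ⋃F? : Decidable (λ z → ∃ λ i → Favours t (a i) (b i) z)
  ⋃F? z = any? λ i → F? i z
  distinct : ∀ i → a i ≢ b i
  distinct i a≡b = n≮0 (≤-trans (far i) (≤-reflexive (trans (cong (d (a i)) (sym a≡b)) (dist-refl (a i)))))
  disjoint : ∀ i j → i ≢ j → Favours t (a i) (b i) ⊥ Favours t (a j) (b j)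
  disjoint i j i≢j (fav , fav′) =
    n≮n (2 * t) (≤-trans (favours-separated (distinct i) (distinct j) fav fav′) (near i j i≢j))

binaryWord : ∀ k → Fin (2 ^ k) → Vec Bool k
binaryWord zero    _ = []
binaryWord (suc k) i = Inverse.to 2↔Bool (proj₁ digits) ∷ binaryWord k (proj₂ digits)
  where
  digits : Fin 2 × Fin (2 ^ k)
  digits = remQuot (2 ^ k) i

binaryWord-injective : ∀ k → Injective _≡_ _≡_ (binaryWord k)
binaryWord-injective zero    {zero} {zero} _ = refl
binaryWord-injective (suc k) {i} {j} eq = begin
  i                                        ≡⟨ combine-remQuot {2} (2 ^ k) i ⟨
  uncurry combine (remQuot {2} (2 ^ k) i)  ≡⟨ cong (uncurry combine) (cong₂ _,_ same-bit same-rest) ⟩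
  uncurry combine (remQuot {2} (2 ^ k) j)  ≡⟨ combine-remQuot {2} (2 ^ k) j ⟩
  j                                        ∎
  where
  open ≡-Reasoning
  same-bit : proj₁ (remQuot {2} (2 ^ k) i) ≡ proj₁ (remQuot {2} (2 ^ k) j)
  same-bit = Injection.injective (↔⇒↣ 2↔Bool) (∷-injectiveˡ eq)
  same-rest : proj₂ (remQuot {2} (2 ^ k) i) ≡ proj₂ (remQuot {2} (2 ^ k) j)
  same-rest = binaryWord-injective k (∷-injectiveʳ eq)

config-lower : ∀ t → IsConfig _≟ᵇ_ t (2 ^ suc t)
config-lower t = suc t , ≤-refl , map not ∘ w , w , far , near
  where
  w : Fin (2 ^ suc t) → Vec Bool (suc t)
  w = binaryWord (suc t)
  w-injective : Injective _≡_ _≡_ w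
  w-injective = binaryWord-injective (suc t)
  far : ∀ i → suc t ≤ d (map not (w i)) (w i)
  far i = ≤-reflexive (begin
    suc t                                      ≡⟨ dist-not (w i) (w i) ⟨
    d (map not (w i)) (w i) + d (w i) (w i)    ≡⟨ cong (d (map not (w i)) (w i) +_) (dist-refl (w i)) ⟩
    d (map not (w i)) (w i) + 0                ≡⟨ +-identityʳ _ ⟩
    d (map not (w i)) (w i)                    ∎)
    where open ≡-Reasoning
  close : ∀ i j → i ≢ j → d (map not (w i)) (w j) ≤ t
  close i j i≢j = s≤s⁻¹ (begin
    suc (d (map not (w i)) (w j))              ≡⟨ +-comm 1 _ ⟩
    d (map not (w i)) (w j) + 1                ≤⟨ +-monoʳ-≤ _ (n≢0⇒n>0 (i≢j ∘ w-injective ∘ dist≡0⇒≡ (w i) (w j))) ⟩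
    d (map not (w i)) (w j) + d (w i) (w j)    ≡⟨ dist-not (w i) (w j) ⟩
    suc t                                      ∎)
    where open ≤-Reasoning
  near : ∀ i j → i ≢ j → d (map not (w i)) (w j) + d (map not (w j)) (w i) ≤ 2 * t
  near i j i≢j = ≤-trans (+-mono-≤ (close i j i≢j) (close j i (i≢j ∘ sym)))
                         (≤-reflexive (cong (t +_) (sym (+-identityʳ t))))

theorem1p6 : (t : ℕ) → f′≡ _≟ᵇ_ t (2 ^ suc t)
theorem1p6 t = config-lower t , config-upper t
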